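{- Let \(\mathbb{E}\) be the set of positive even integers, \(N\subseteq\mathbb{E}\), \(F\) an ultrafilter over a set \(I\), and \(\mathbf{S}\) a subalgebra of \(\mathbf{D}_N^I/F\). If \(\mathbf{S}\) satisfies \(\forall x\,(x\neq 0\to\Diamond x=1)\), then \(\mathbf{S}\cong\mathsf{Cm}(\mathbb{K}_1)\) or \(\mathbf{S}\cong\mathsf{Cm}(\mathbb{K}_2)\).
   Context: The complex algebra \(\mathsf{Cm}(\langle W;R\rangle)\) is the power set Boolean algebra of \(W\) with \(\Diamond X=\{w\in W\mid w\,R\,x\text{ for some }x\in X\}\); \(\mathbb{K}_n\) is an \(n\)-element set with the total relation. The frame \(\mathbb{F}_N=\langle W;R_N\rangle\): \(W\) consists of pairwise distinct elements \(a,b_1,b_2,b_3,c_1,c_2,d\), \(u_i\) (\(i\geqslant 1\)) and \(\ell_i\) (\(i\geqslant 0\)); \(R_N\) is the reflexive symmetric relation on \(W\) whose non-loop edges \(\{x,y\}\) are exactly: \(\{a,b_i\}\) for \(i\in\{1,2,3\}\); \(\{b_i,c_i\}\) for \(i\in\{1,2\}\); \(\{c_1,d\}\); \(\{\ell_0,\ell_1\}\); \(\{a,\ell_i\}\) for all \(i\geqslant 0\); \(\{\ell_i,u_i\}\) for all \(i\geqslant 1\); \(\{\ell_i,u_{i-1}\}\) for \(i\in\mathbb{E}\); \(\{\ell_i,u_{i+1}\}\) for \(i\in N\); \(\{\ell_{i+1},u_i\}\) for \(i\in\mathbb{E}\setminus N\). \(\mathbf{D}_N\) is the subalgebra of \(\mathsf{Cm}(\mathbb{F}_N)\)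 generated by \(\{d\}\). -}

module Defs where

open import Data.Nat using (ℕ; zero; suc; _≤_)
open import Data.Nat.Divisibility using (_∣_)
open import Data.Fin using (Fin)
open import Data.Product using (Σ; _×_; _,_; proj₁; proj₂)
open import Data.Sum using (_⊎_)
open import Data.Unit using (⊤)
open import Data.Empty using (⊥)
open import Relation.Nullary using (¬_)
open import Relation.Binary.PropositionalEquality using (_≡_)

record BAO : Set₂ where
  infix 4 _≈_
  field
    Carrier : Set₁
    _≈_     : Carrier → Carrier → Set
    𝟘       : Carrier
    ∼_      : Carrier → Carrier
    _∨_     : Carrier → Carrier → Carrier
    ◇       : Carrier → Carrier
  𝟙 : Carrier
  𝟙 = ∼ 𝟘

record Frame : Set₁ where
  field
    World : Set
    Rel   : World → World → Set

_≐_ : {W : Set} → (W → Set) → (W → Set) → Set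
X ≐ Y = ∀ w → (X w → Y w) × (Y w → X w)

module CmOps (F : Frame) where
  open Frame F
  ∅ : World → Set
  ∅ _ = ⊥
  ∁ : (World → Set) → World → Set
  ∁ X w = ¬ X w
  _∪_ : (World → Set) → (World → Set) → World → Set
  (X ∪ Y) w = X w ⊎ Y w
  ◇ : (World → Set) → World → Set
  ◇ X w = Σ World (λ x → Rel w x × X x)

Cm : Frame → BAO
Cm F = record
  { Carrier = Frame.World F → Set
  ; _≈_ = _≐_
  ; 𝟘 = ∅
  ; ∼_ = ∁
  ; _∨_ = _∪_
  ; ◇ = ◇
  }
  where open CmOps F

𝕂 : ℕ → Frame
𝕂 n = record { World = Fin n ; Rel = λ _ _ → ⊤ }

PosEven : ℕ → Set
PosEven i = 1 ≤ i × 2 ∣ i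

data W : Set where
  a b₁ b₂ b₃ c₁ c₂ d : W
  u : ℕ → W   -- u k  denotes  u_{k+1}   (so the u's are u_1, u_2, ...)
  ℓ : ℕ → W   -- ℓ i  denotes  ℓ_i       (i ≥ 0)

data Edge (N : ℕ → Set) : W → W → Set where
  ab₁  : Edge N a b₁
  ab₂  : Edge N a b₂
  ab₃  : Edge N a b₃
  bc₁  : Edge N b₁ c₁
  bc₂  : Edge N b₂ c₂
  c₁d  : Edge N c₁ d
  ℓ₀ℓ₁ : Edge N (ℓ 0) (ℓ 1)
  aℓ   : ∀ i → Edge N a (ℓ i)
  -- {ℓ_i, u_i}, i ≥ 1   (i = k+1)
  ℓu   : ∀ k → Edge N (ℓ (suc k)) (u k)
  -- {ℓ_i, u_{i-1}}, i ∈ 𝔼   (i = k+2, u_{i-1} = u_{k+1})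
  ℓu⁻  : ∀ k → PosEven (suc (suc k)) → Edge N (ℓ (suc (suc k))) (u k)
  -- {ℓ_i, u_{i+1}}, i ∈ N   (i = k+1, u_{i+1} = u_{k+2})
  ℓu⁺  : ∀ k → N (suc k) → Edge N (ℓ (suc k)) (u (suc k))
  -- {ℓ_{i+1}, u_i}, i ∈ 𝔼 ∖ N   (i = k+1)
  ℓ⁺u  : ∀ k → PosEven (suc k) → ¬ N (suc k) → Edge N (ℓ (suc (suc k))) (u k)

R : (N : ℕ → Set) → W → W → Set
R N x y = x ≡ y ⊎ Edge N x y ⊎ Edge N y x

𝔽 : (N : ℕ → Set) → Frame
𝔽 N = record { World = W ; Rel = R N }

module _ (N : ℕ → Set) where
  open CmOps (𝔽 N)

  data InD : (W → Set) → Set₁ where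
    gen   : InD (λ w → w ≡ d)
    zero  : InD ∅
    compl : ∀ {X} → InD X → InD (∁ X)
    join  : ∀ {X Y} → InD X → InD Y → InD (X ∪ Y)
    dia   : ∀ {X} → InD X → InD (◇ X)
    resp  : ∀ {X Y} → InD X → X ≐ Y → InD Y

  𝐃 : BAO
  𝐃 = record
    { Carrier = Σ (W → Set) InD
    ; _≈_ = λ x y → proj₁ x ≐ proj₁ y
    ; 𝟘 = ∅ , zero
    ; ∼_ = λ x → ∁ (proj₁ x) , compl (proj₂ x)
    ; _∨_ = λ x y → (proj₁ x ∪ proj₁ y) , join (proj₂ x) (proj₂ y)
    ; ◇ = λ x → ◇ (proj₁ x) , dia (proj₂ x)
    }

record IsUltrafilter (I : Set) (F : (I → Set) → Set) : Set₁ where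
  field
    full   : F (λ _ → ⊤)
    proper : ¬ F (λ _ → ⊥)
    upward : ∀ {A B : I → Set} → F A → (∀ i → A i → B i) → F B
    meet   : ∀ {A B : I → Set} → F A → F B → F (λ i → A i × B i)
    ultra  : ∀ (A : I → Set) → F A ⊎ F (λ i → ¬ A i)

-- A^I / F  (quotient represented as a setoid)
Ultrapower : BAO → (I : Set) → ((I → Set) → Set) → BAO
Ultrapower A I F = record
  { Carrier = I → Carrier
  ; _≈_ = λ f g → F (λ i → f i ≈ g i)
  ; 𝟘 = λ _ → 𝟘
  ; ∼_ = λ f i → ∼ f i
  ; _∨_ = λ f g i → f i ∨ g i
  ; ◇ = λ f i → ◇ (f i)
  }
  where open BAO A

record IsSubalgebra (A : BAO) (S : BAO.Carrier A → Set) : Set₁ where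
  open BAO A
  field
    respects : ∀ {x y} → x ≈ y → S x → S y
    has𝟘     : S 𝟘
    closed∼  : ∀ {x} → S x → S (∼ x)
    closed∨  : ∀ {x y} → S x → S y → S (x ∨ y)
    closed◇  : ∀ {x} → S x → S (◇ x)

Sub : (A : BAO) (S : BAO.Carrier A → Set) → IsSubalgebra A S → BAO
Sub A S sub = record
  { Carrier = Σ Carrier S
  ; _≈_ = λ x y → proj₁ x ≈ proj₁ y
  ; 𝟘 = 𝟘 , has𝟘
  ; ∼_ = λ x → ∼ proj₁ x , closed∼ (proj₂ x)
  ; _∨_ = λ x y → (proj₁ x ∨ proj₁ y) , closed∨ (proj₂ x) (proj₂ y)
  ; ◇ = λ x → ◇ (proj₁ x) , closed◇ (proj₂ x)
  }
  where
  open BAO A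
  open IsSubalgebra sub

Sat◇ : BAO → Set₁
Sat◇ A = ∀ x → ¬ (x ≈ 𝟘) → ◇ x ≈ 𝟙
  where open BAO A

record _≅_ (A B : BAO) : Set₁ where
  module A = BAO A
  module B = BAO B
  field
    to      : A.Carrier → B.Carrier
    from    : B.Carrier → A.Carrier
    to-cong   : ∀ {x y} → x A.≈ y → to x B.≈ to y
    from-cong : ∀ {x y} → x B.≈ y → from x A.≈ from y
    to-from : ∀ y → to (from y) B.≈ y
    from-to : ∀ x → from (to x) A.≈ x
    to-𝟘    : to A.𝟘 B.≈ B.𝟘
    to-∼    : ∀ x → to (A.∼ x) B.≈ B.∼ (to x)
    to-∨    : ∀ x y → to (x A.∨ y) B.≈ (to x B.∨ to y)
    to-◇    : ∀ x → to (A.◇ x) B.≈ B.◇ (to x)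

-- In 𝔽_N the world d sees only d and c₁.  If ◇x = 1 then x contains d or c₁
-- (in almost every coordinate), so the subalgebra cannot contain three pairwise
-- disjoint nonzero elements.  Hence either 0 and 1 are its only elements, or a
-- nontrivial element e and its complement are atoms below which every element
-- is decided.  In both cases the map x ↦ {atoms below x} is an isomorphism onto
-- the power set of the atoms, and ◇ becomes the total relation because every
-- nonzero element has ◇x = 1.
module Submission where

open import Defs
open import Axiom.DoubleNegationElimination using (em⇒dne)
open import Axiom.ExcludedMiddle using (ExcludedMiddle)
open import Data.Empty using (⊥; ⊥-elim)
open import Data.Fin using (Fin; zero; suc; _≟_)
open import Data.Nat using (ℕ)
open import Data.Product using (Σ; ∃; _×_; _,_; proj₁; proj₂)
open import Data.Sum using (_⊎_; inj₁; inj₂)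
open import Data.Unit using (⊤; tt)
open import Function using (case_of_)
open import Level using (0ℓ)
open import Relation.Binary.PropositionalEquality using (_≡_; _≢_; refl)
open import Relation.Nullary using (¬_; yes; no)
open import Relation.Unary using (Pred; _⊆′_; Universal)

Disjoint : {A : Set} → Pred A 0ℓ → Pred A 0ℓ → Set
Disjoint P Q = ∀ {x} → P x → Q x → ⊥

module _ (𝔉 : Frame) where
  open Frame 𝔉
  open CmOps 𝔉

  ◇-universal-meets : ∀ {w₀ y₁ y₂} → (∀ {y} → Rel w₀ y → y ≡ y₁ ⊎ y ≡ y₂)
    → ∀ {A} → Π[ ◇ A ] → A y₁ ⊎ A y₂
  ◇-universal-meets {w₀} succ ◇A with ◇A w₀
  ... | y , w₀Ry , Ay with succ w₀Ry
  ... | inj₁ refl = inj₁ Ay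
  ... | inj₂ refl = inj₂ Ay

  no-three-disjoint-◇-universal : ∀ {w₀ y₁ y₂} → (∀ {y} → Rel w₀ y → y ≡ y₁ ⊎ y ≡ y₂)
    → ∀ {A B C} → Π[ ◇ A ] → Π[ ◇ B ] → Π[ ◇ C ]
    → Disjoint A B → Disjoint A C → Disjoint B C → ⊥
  no-three-disjoint-◇-universal succ ◇A ◇B ◇C A⊥B A⊥C B⊥C
    with ◇-universal-meets succ ◇A | ◇-universal-meets succ ◇B | ◇-universal-meets succ ◇C
  ... | inj₁ A₁ | inj₁ B₁ | _      = A⊥B A₁ B₁
  ... | inj₂ A₂ | inj₂ B₂ | _      = A⊥B A₂ B₂
  ... | inj₁ A₁ | inj₂ _  | inj₁ C₁ = A⊥C A₁ C₁
  ... | inj₁ _  | inj₂ B₂ | inj₂ C₂ = B⊥C B₂ C₂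
  ... | inj₂ _  | inj₁ B₁ | inj₁ C₁ = B⊥C B₁ C₁
  ... | inj₂ A₂ | inj₁ _  | inj₂ C₂ = A⊥C A₂ C₂

R-d : ∀ {N y} → R N d y → y ≡ d ⊎ y ≡ c₁
R-d (inj₁ refl)        = inj₁ refl
R-d (inj₂ (inj₁ ()))
R-d (inj₂ (inj₂ c₁d)) = inj₂ refl

module _ {I : Set} {F : (I → Set) → Set} (uf : IsUltrafilter I F) where
  open IsUltrafilter uf

  upward₂ : ∀ {A B C : I → Set} → F A → F B → (∀ i → A i → B i → C i) → F C
  upward₂ FA FB f = upward (meet FA FB) (λ i AB → f i (proj₁ AB) (proj₂ AB))

  refute : ∀ {A : I → Set} → F A → (∀ i → ¬ A i) → ⊥
  refute FA ¬A = proper (upward FA ¬A)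

  F-∀Fin : ∀ n {A : Fin n → I → Set} → (∀ k → F (A k)) → F (λ i → ∀ k → A k i)
  F-∀Fin ℕ.zero    FA = upward full (λ _ _ ())
  F-∀Fin (ℕ.suc n) FA = upward₂ (FA zero) (F-∀Fin n (λ k → FA (suc k)))
    λ { i A₀ A₊ zero → A₀ ; i A₀ A₊ (suc k) → A₊ k }

module SubalgebraOfUltrapower
  (lem : ∀ {ℓ} → ExcludedMiddle ℓ) (N : ℕ → Set)
  (I : Set) (F : (I → Set) → Set) (uf : IsUltrafilter I F)
  (S : BAO.Carrier (Ultrapower (𝐃 N) I F) → Set)
  (sub : IsSubalgebra (Ultrapower (𝐃 N) I F) S)
  (sat : Sat◇ (Sub (Ultrapower (𝐃 N) I F) S sub))
  where

  SA : BAO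
  SA = Sub (Ultrapower (𝐃 N) I F) S sub

  open IsUltrafilter uf
  open BAO SA

  dne : ∀ {ℓ} {P : Set ℓ} → ¬ ¬ P → P
  dne = em⇒dne lem

  ev : Carrier → I → Pred W _
  ev x i = proj₁ (proj₁ x i)

  infix 4 _⊑_
  _⊑_ : Carrier → Carrier → Set
  x ⊑ y = F (λ i → ev x i ⊆′ ev y i)

  infixr 6 _∧_
  _∧_ : Carrier → Carrier → Carrier
  x ∧ y = ∼ ((∼ x) ∨ (∼ y))

  DisjointEverywhere : Carrier → Carrier → Set
  DisjointEverywhere x y = ∀ i → Disjoint (ev x i) (ev y i)

  ≈-sym : ∀ x y → x ≈ y → y ≈ x
  ≈-sym x y x≈y = upward x≈y (λ i x≐y w → proj₂ (x≐y w) , proj₁ (x≐y w))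

  ⊑-respʳ-≈ : ∀ p x y → x ≈ y → p ⊑ x → p ⊑ y
  ⊑-respʳ-≈ p x y x≈y p⊑x = upward₂ uf x≈y p⊑x (λ i x≐y p⊆x w px → proj₁ (x≐y w) (p⊆x w px))

  ⊑𝟘⇒≈𝟘 : ∀ x → x ⊑ 𝟘 → x ≈ 𝟘
  ⊑𝟘⇒≈𝟘 x x⊑𝟘 = upward x⊑𝟘 (λ i x⊆∅ w → x⊆∅ w , λ ())

  ⊑-≈𝟙 : ∀ p x → x ≈ 𝟙 → p ⊑ x
  ⊑-≈𝟙 p x x≈𝟙 = upward x≈𝟙 (λ i x≐W w _ → proj₂ (x≐W w) (λ ()))

  ⊑-≈𝟘 : ∀ p x → p ⊑ x → x ≈ 𝟘 → p ≈ 𝟘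
  ⊑-≈𝟘 p x p⊑x x≈𝟘 = ⊑𝟘⇒≈𝟘 p (⊑-respʳ-≈ p x 𝟘 x≈𝟘 p⊑x)

  ⊑×⊑∼⇒≈𝟘 : ∀ p x → p ⊑ x → p ⊑ ∼ x → p ≈ 𝟘
  ⊑×⊑∼⇒≈𝟘 p x p⊑x p⊑∼x =
    ⊑𝟘⇒≈𝟘 p (upward₂ uf p⊑x p⊑∼x (λ i p⊆x p⊆∼x w px → p⊆∼x w px (p⊆x w px)))

  ⊑∼∼⇒⊑ : ∀ p x → p ⊑ ∼ ∼ x → p ⊑ x
  ⊑∼∼⇒⊑ p x p⊑∼∼x = upward p⊑∼∼x (λ i p⊆∼∼x w px → dne (p⊆∼∼x w px))

  ∧≈𝟘⇒⊑∼ : ∀ p x → p ∧ x ≈ 𝟘 → p ⊑ ∼ x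
  ∧≈𝟘⇒⊑∼ p x p∧x≈𝟘 = upward p∧x≈𝟘 λ i p∧x≐∅ w px xx →
    proj₁ (p∧x≐∅ w) λ { (inj₁ ¬px) → ¬px px ; (inj₂ ¬xx) → ¬xx xx }

  ev-∧ : ∀ x y {i w} → ev (x ∧ y) i w → ev x i w × ev y i w
  ev-∧ x y x∧y = dne (λ ¬x → x∧y (inj₁ ¬x)) , dne (λ ¬y → x∧y (inj₂ ¬y))

  ◇-≈𝟘 : ∀ x → x ≈ 𝟘 → ◇ x ≈ 𝟘
  ◇-≈𝟘 x x≈𝟘 = upward x≈𝟘 λ i x≐∅ w → (λ { (y , _ , xy) → proj₁ (x≐∅ y) xy }) , λ ()

  ≉𝟘⇒◇-universal : ∀ x → ¬ x ≈ 𝟘 → F (λ i → Π[ CmOps.◇ (𝔽 N) (ev x i) ])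
  ≉𝟘⇒◇-universal x x≉𝟘 = upward (sat x x≉𝟘) (λ i ◇x≐W w → proj₂ (◇x≐W w) (λ ()))

  no-three-disjoint-nonzero : ∀ x y z → ¬ x ≈ 𝟘 → ¬ y ≈ 𝟘 → ¬ z ≈ 𝟘
    → DisjointEverywhere x y → DisjointEverywhere x z → DisjointEverywhere y z → ⊥
  no-three-disjoint-nonzero x y z x≉𝟘 y≉𝟘 z≉𝟘 x⊥y x⊥z y⊥z =
    refute uf (meet (meet (≉𝟘⇒◇-universal x x≉𝟘) (≉𝟘⇒◇-universal y y≉𝟘)) (≉𝟘⇒◇-universal z z≉𝟘))
      λ { i ((◇x , ◇y) , ◇z) →
        no-three-disjoint-◇-universal (𝔽 N) R-d ◇x ◇y ◇z (x⊥y i) (x⊥z i) (y⊥z i) }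

  Decides : Carrier → Set₁
  Decides p = ∀ x → p ⊑ x ⊎ p ⊑ ∼ x

  -- Otherwise p ∧ x, p ∧ ∼x and q would be three disjoint nonzero elements.
  disjoint-nonzero⇒decides : ∀ p q → ¬ q ≈ 𝟘 → DisjointEverywhere p q → Decides p
  disjoint-nonzero⇒decides p q q≉𝟘 p⊥q x with lem {P = p ⊑ x} | lem {P = p ⊑ ∼ x}
  ... | yes p⊑x | _        = inj₁ p⊑x
  ... | no _    | yes p⊑∼x = inj₂ p⊑∼x
  ... | no p⋢x  | no p⋢∼x  = ⊥-elim (no-three-disjoint-nonzero (p ∧ x) (p ∧ ∼ x) q
        (λ p∧x≈𝟘 → p⋢∼x (∧≈𝟘⇒⊑∼ p x p∧x≈𝟘))
        (λ p∧∼x≈𝟘 → p⋢x (⊑∼∼⇒⊑ p x (∧≈𝟘⇒⊑∼ p (∼ x) p∧∼x≈𝟘)))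
        q≉𝟘
        (λ i p∧x p∧∼x → proj₂ (ev-∧ p (∼ x) p∧∼x) (proj₂ (ev-∧ p x p∧x)))
        (λ i p∧x qw → p⊥q i (proj₁ (ev-∧ p x p∧x)) qw)
        (λ i p∧∼x qw → p⊥q i (proj₁ (ev-∧ p (∼ x) p∧∼x)) qw))

  ⋁ : ∀ {m} → (Fin m → Carrier) → Carrier
  ⋁ {ℕ.zero}  f = 𝟘
  ⋁ {ℕ.suc m} f = f zero ∨ ⋁ (λ k → f (suc k))

  ev-⋁⁺ : ∀ {m} {f : Fin m → Carrier} {i w} k → ev (f k) i w → ev (⋁ f) i w
  ev-⋁⁺ {ℕ.suc m} zero    fk = inj₁ fk
  ev-⋁⁺ {ℕ.suc m} (suc k) fk = inj₂ (ev-⋁⁺ k fk)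

  ev-⋁⁻ : ∀ {m} {f : Fin m → Carrier} {i w} → ev (⋁ f) i w → ∃ λ k → ev (f k) i w
  ev-⋁⁻ {ℕ.suc m} (inj₁ f₀) = zero , f₀
  ev-⋁⁻ {ℕ.suc m} (inj₂ f₊) with ev-⋁⁻ f₊
  ... | k , fk = suc k , fk

  record AtomPartition (n : ℕ) : Set₁ where
    field
      atom     : Fin n → Carrier
      nonzero  : ∀ k → ¬ atom k ≈ 𝟘
      decides  : ∀ k → Decides (atom k)
      disjoint : ∀ {k k′} → k ≢ k′ → DisjointEverywhere (atom k) (atom k′)
      cover    : ∀ i w → ∃ λ k → ev (atom k) i w

  module _ {n} (P : AtomPartition n) where
    open AtomPartition P

    atomsIn : (Fin n → Set) → Fin n → Carrier
    atomsIn X k with lem {P = X k}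
    ... | yes _ = atom k
    ... | no _  = 𝟘

    ev-atomsIn⁺ : ∀ {X k i w} → X k → ev (atom k) i w → ev (atomsIn X k) i w
    ev-atomsIn⁺ {X} {k} Xk ak with lem {P = X k}
    ... | yes _  = ak
    ... | no ¬Xk = ¬Xk Xk

    ev-atomsIn⁻ : ∀ {X k i w} → ev (atomsIn X k) i w → X k × ev (atom k) i w
    ev-atomsIn⁻ {X} {k} with lem {P = X k}
    ... | yes Xk = Xk ,_
    ... | no _   = λ ()

    atomJoin : (Fin n → Set) → Carrier
    atomJoin X = ⋁ (atomsIn X)

    ev-atomJoin⁺ : ∀ X {i w} k → X k → ev (atom k) i w → ev (atomJoin X) i w
    ev-atomJoin⁺ X k Xk ak = ev-⋁⁺ {f = atomsIn X} k (ev-atomsIn⁺ Xk ak)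

    ev-atomJoin⁻ : ∀ X {i w} → ev (atomJoin X) i w → ∃ λ k → X k × ev (atom k) i w
    ev-atomJoin⁻ X jw = let k , ak = ev-⋁⁻ {f = atomsIn X} jw in k , ev-atomsIn⁻ {X} ak

    ⋢⇒⊑∼ : ∀ k x → ¬ atom k ⊑ x → atom k ⊑ ∼ x
    ⋢⇒⊑∼ k x a⋢x with decides k x
    ... | inj₁ a⊑x  = ⊥-elim (a⋢x a⊑x)
    ... | inj₂ a⊑∼x = a⊑∼x

    ⊑⇒≉𝟘 : ∀ k x → atom k ⊑ x → ¬ x ≈ 𝟘
    ⊑⇒≉𝟘 k x a⊑x x≈𝟘 = nonzero k (⊑-≈𝟘 (atom k) x a⊑x x≈𝟘)

    no-atom-below⇒≈𝟘 : ∀ x → (∀ k → ¬ atom k ⊑ x) → x ≈ 𝟘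
    no-atom-below⇒≈𝟘 x no-atom = ⊑𝟘⇒≈𝟘 x
      (upward (F-∀Fin uf n (λ k → ⋢⇒⊑∼ k x (no-atom k))) λ i a⊆∼x w xw →
        let k , aw = cover i w in a⊆∼x k w aw xw)

    atom-⊑-atomJoin : ∀ X k → (atom k ⊑ atomJoin X → X k) × (X k → atom k ⊑ atomJoin X)
    atom-⊑-atomJoin X k =
        (λ a⊑⋁ → dne λ ¬Xk → nonzero k (⊑𝟘⇒≈𝟘 (atom k) (upward a⊑⋁ λ i a⊆⋁ w ak →
          let k′ , Xk′ , ak′ = ev-atomJoin⁻ X (a⊆⋁ w ak) in other-atom ¬Xk k′ Xk′ ak′ ak)))
      , λ Xk → upward full (λ i _ w → ev-atomJoin⁺ X k Xk)
      where
      other-atom : ¬ X k → ∀ {i w} k′ → X k′ → ev (atom k′) i w → ev (atom k) i w → ⊥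
      other-atom ¬Xk k′ Xk′ ak′ ak with k′ ≟ k
      ... | yes refl = ¬Xk Xk′
      ... | no k′≢k  = disjoint k′≢k _ ak′ ak

    atoms-locally-decided : ∀ x → F (λ i → ∀ k →
      (atom k ⊑ x → ev (atom k) i ⊆′ ev x i) × (¬ atom k ⊑ x → ev (atom k) i ⊆′ ev (∼ x) i))
    atoms-locally-decided x = F-∀Fin uf n decided
      where
      decided : ∀ k → F (λ i →
        (atom k ⊑ x → ev (atom k) i ⊆′ ev x i) × (¬ atom k ⊑ x → ev (atom k) i ⊆′ ev (∼ x) i))
      decided k with lem {P = atom k ⊑ x}
      ... | yes a⊑x = upward a⊑x (λ i a⊆x → (λ _ → a⊆x) , (λ a⋢x → ⊥-elim (a⋢x a⊑x)))
      ... | no a⋢x  = upward (⋢⇒⊑∼ k x a⋢x) (λ i a⊆∼x → (λ a⊑x → ⊥-elim (a⋢x a⊑x)) , (λ _ → a⊆∼x))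

    atomJoin-atomsBelow : ∀ x → atomJoin (λ k → atom k ⊑ x) ≈ x
    atomJoin-atomsBelow x = upward (atoms-locally-decided x) λ i decided w →
        (λ jw → let k , a⊑x , ak = ev-atomJoin⁻ (λ k → atom k ⊑ x) jw in proj₁ (decided k) a⊑x w ak)
      , (λ xw → let k , ak = cover i w in case lem {P = atom k ⊑ x} of λ
          { (yes a⊑x) → ev-atomJoin⁺ (λ k → atom k ⊑ x) k a⊑x ak
          ; (no a⋢x)  → ⊥-elim (proj₂ (decided k) a⋢x w ak xw) })

    atom-⊑-∨ : ∀ x y k → (atom k ⊑ x ∨ y → atom k ⊑ x ⊎ atom k ⊑ y)
                       × (atom k ⊑ x ⊎ atom k ⊑ y → atom k ⊑ x ∨ y)
    atom-⊑-∨ x y k = split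
                   , λ { (inj₁ a⊑x) → upward a⊑x (λ i a⊆x w ak → inj₁ (a⊆x w ak))
                       ; (inj₂ a⊑y) → upward a⊑y (λ i a⊆y w ak → inj₂ (a⊆y w ak)) }
      where
      split : atom k ⊑ x ∨ y → atom k ⊑ x ⊎ atom k ⊑ y
      split a⊑x∨y with decides k x | decides k y
      ... | inj₁ a⊑x  | _         = inj₁ a⊑x
      ... | inj₂ _    | inj₁ a⊑y  = inj₂ a⊑y
      ... | inj₂ a⊑∼x | inj₂ a⊑∼y = ⊥-elim (nonzero k (⊑𝟘⇒≈𝟘 (atom k)
        (upward₂ uf a⊑x∨y (meet a⊑∼x a⊑∼y) λ i a⊆x∨y a⊆∼x∧∼y w ak →
          case a⊆x∨y w ak of λ
            { (inj₁ xw) → proj₁ a⊆∼x∧∼y w ak xw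
            ; (inj₂ yw) → proj₂ a⊆∼x∧∼y w ak yw })))

    atom-⊑-◇ : ∀ x k → (atom k ⊑ ◇ x → ∃ λ k′ → ⊤ × atom k′ ⊑ x)
                     × ((∃ λ k′ → ⊤ × atom k′ ⊑ x) → atom k ⊑ ◇ x)
    atom-⊑-◇ x k =
        (λ a⊑◇x → dne λ ∄ → nonzero k (⊑-≈𝟘 (atom k) (◇ x) a⊑◇x
          (◇-≈𝟘 x (no-atom-below⇒≈𝟘 x λ k′ a′⊑x → ∄ (k′ , tt , a′⊑x)))))
      , λ { (k′ , _ , a′⊑x) → ⊑-≈𝟙 (atom k) (◇ x) (sat x (⊑⇒≉𝟘 k′ x a′⊑x)) }

    ≅Cm𝕂 : SA ≅ Cm (𝕂 n)
    ≅Cm𝕂 = record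
      { to        = λ x k → atom k ⊑ x
      ; from      = atomJoin
      ; to-cong   = λ {x} {y} x≈y k →
          ⊑-respʳ-≈ (atom k) x y x≈y , ⊑-respʳ-≈ (atom k) y x (≈-sym x y x≈y)
      ; from-cong = λ X≐Y → upward full λ i _ w →
          (λ jw → let k , Xk , ak = ev-atomJoin⁻ _ jw in ev-atomJoin⁺ _ k (proj₁ (X≐Y k) Xk) ak) ,
          (λ jw → let k , Yk , ak = ev-atomJoin⁻ _ jw in ev-atomJoin⁺ _ k (proj₂ (X≐Y k) Yk) ak)
      ; to-from   = atom-⊑-atomJoin
      ; from-to   = atomJoin-atomsBelow
      ; to-𝟘      = λ k → (λ a⊑𝟘 → nonzero k (⊑𝟘⇒≈𝟘 (atom k) a⊑𝟘)) , λ ()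
      ; to-∼      = λ x k → (λ a⊑∼x a⊑x → nonzero k (⊑×⊑∼⇒≈𝟘 (atom k) x a⊑x a⊑∼x)) , ⋢⇒⊑∼ k x
      ; to-∨      = atom-⊑-∨
      ; to-◇      = atom-⊑-◇
      }

  ¬𝟙≈𝟘 : ¬ 𝟙 ≈ 𝟘
  ¬𝟙≈𝟘 𝟙≈𝟘 = refute uf 𝟙≈𝟘 (λ i 𝟙≐∅ → proj₁ (𝟙≐∅ a) (λ ()))

  trivial-partition : (∀ x → x ≈ 𝟘 ⊎ x ≈ 𝟙) → AtomPartition 1
  trivial-partition 𝟘-or-𝟙 = record
    { atom     = λ _ → 𝟙
    ; nonzero  = λ _ → ¬𝟙≈𝟘
    ; decides  = λ _ x → case 𝟘-or-𝟙 x of λ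
        { (inj₁ x≈𝟘) → inj₂ (upward x≈𝟘 (λ i x≐∅ w _ xw → proj₁ (x≐∅ w) xw))
        ; (inj₂ x≈𝟙) → inj₁ (⊑-≈𝟙 𝟙 x x≈𝟙) }
    ; disjoint = λ { {zero} {zero} 0≢0 → ⊥-elim (0≢0 refl) }
    ; cover    = λ i w → zero , λ ()
    }

  complement-partition : ∀ e → ¬ e ≈ 𝟘 → ¬ e ≈ 𝟙 → AtomPartition 2
  complement-partition e e≉𝟘 e≉𝟙 = record
    { atom     = atom
    ; nonzero  = nonzero
    ; decides  = λ
        { zero       → disjoint-nonzero⇒decides e (∼ e) (nonzero (suc zero)) (disjoint {zero} {suc zero} λ ())
        ; (suc zero) → disjoint-nonzero⇒decides (∼ e) e e≉𝟘 (disjoint {suc zero} {zero} λ ()) }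
    ; disjoint = disjoint
    ; cover    = λ i w → case lem {P = ev e i w} of λ
        { (yes ew) → zero , ew
        ; (no ¬ew) → suc zero , ¬ew }
    }
    where
    atom : Fin 2 → Carrier
    atom zero       = e
    atom (suc zero) = ∼ e

    nonzero : ∀ k → ¬ atom k ≈ 𝟘
    nonzero zero             = e≉𝟘
    nonzero (suc zero) ∼e≈𝟘 = e≉𝟙 (upward ∼e≈𝟘 λ i ∼e≐∅ w → (λ _ ()) , λ _ → dne (proj₁ (∼e≐∅ w)))

    disjoint : ∀ {k k′} → k ≢ k′ → DisjointEverywhere (atom k) (atom k′)
    disjoint {zero}     {zero}     0≢0 = ⊥-elim (0≢0 refl)
    disjoint {zero}     {suc zero} _   = λ i ew ¬ew → ¬ew ew
    disjoint {suc zero} {zero}     _   = λ i ¬ew ew → ¬ew ew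
    disjoint {suc zero} {suc zero} 1≢1 = ⊥-elim (1≢1 refl)

  classification : (SA ≅ Cm (𝕂 1)) ⊎ (SA ≅ Cm (𝕂 2))
  classification with lem {P = Σ Carrier λ e → ¬ e ≈ 𝟘 × ¬ e ≈ 𝟙}
  ... | yes (e , e≉𝟘 , e≉𝟙) = inj₂ (≅Cm𝕂 (complement-partition e e≉𝟘 e≉𝟙))
  ... | no ∄                = inj₁ (≅Cm𝕂 (trivial-partition 𝟘-or-𝟙))
    where
    𝟘-or-𝟙 : ∀ x → x ≈ 𝟘 ⊎ x ≈ 𝟙
    𝟘-or-𝟙 x with lem {P = x ≈ 𝟘} | lem {P = x ≈ 𝟙}
    ... | yes x≈𝟘 | _       = inj₁ x≈𝟘
    ... | no _    | yes x≈𝟙 = inj₂ x≈𝟙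
    ... | no x≉𝟘  | no x≉𝟙  = ⊥-elim (∄ (x , x≉𝟘 , x≉𝟙))

lemma3p9 : (lem : ∀ {ℓ} → ExcludedMiddle ℓ)
    → (N : ℕ → Set) → (∀ i → N i → PosEven i)
    → (I : Set) (F : (I → Set) → Set) → IsUltrafilter I F
    → (S : BAO.Carrier (Ultrapower (𝐃 N) I F) → Set)
    → (sub : IsSubalgebra (Ultrapower (𝐃 N) I F) S)
    → Sat◇ (Sub (Ultrapower (𝐃 N) I F) S sub)
    → (Sub (Ultrapower (𝐃 N) I F) S sub ≅ Cm (𝕂 1))
      ⊎ (Sub (Ultrapower (𝐃 N) I F) S sub ≅ Cm (𝕂 2))
lemma3p9 lem N _ I F uf S sub sat = classification
  where open SubalgebraOfUltrapower lem N I F uf S sub sat
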